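{- Let $k\ge 1$ and $p_1,\dots,p_k\ge 1$ be integers, let $s_1,\dots,s_k\ge 0$ be integers, and let $a_{ij}\ge 1$ ($1\le i\le k$, $1\le j\le p_i$) be integers. Let $A(n)$ be a solution sequence of the nested recursion $$A(n)=\sum_{i=1}^k A\Big(n-s_i-\sum_{j=1}^{p_i}A(n-a_{ij})\Big)\qquad (n>c),$$ with positive initial values $A(1),\dots,A(c)$, where the solution is well defined for all $n$ (i.e. every argument appearing on the right-hand side is a positive integer). Suppose that $A(n)/n$ converges to a limit $L\neq 0$ as $n\to\infty$. Then $$L=\frac{k-1}{\sum_{i=1}^k p_i}.$$ In particular, if $k=2$ and $p_1=p_2=p$, then $L=\frac{1}{2p}$. -}

module Defs where

open import Data.Nat using (ℕ; zero; suc; _+_; _∸_; _≤_; _<_)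
open import Data.Fin using (Fin; zero; suc)
open import Data.Integer using (+_)
open import Data.Rational using (ℚ; 0ℚ; _/_; _-_; ∣_∣; Positive)
import Data.Rational as ℚ
open import Data.Product using (Σ; ∃; _×_)

sumFin : ∀ {n} → (Fin n → ℕ) → ℕ
sumFin {zero}  f = 0
sumFin {suc n} f = f zero + sumFin (λ i → f (suc i))

-- the rational a / b (with the junk value 0 when b = 0; only used with b ≥ 1)
frac : ℕ → ℕ → ℚ
frac a zero    = 0ℚ
frac a (suc b) = (+ a) / suc b

-- Data of the nested recursion:
--   k      : number of terms
--   p i    : number of inner terms of the i-th term   (i : Fin k)
--   s i    : shift s_i
--   a i j  : inner shifts a_{ij}                      (j : Fin (p i))
-- The argument of the i-th outer term at n:  n - s_i - Σ_j A(n - a_{ij}).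
innerSum : (k : ℕ) (p : Fin k → ℕ) (a : (i : Fin k) → Fin (p i) → ℕ)
           (A : ℕ → ℕ) (n : ℕ) (i : Fin k) → ℕ
innerSum k p a A n i = sumFin (λ j → A (n ∸ a i j))

-- A (indexed by positive integers; A 0 is irrelevant) is a well-defined
-- solution of the recursion with positive initial values A(1..c).
IsWellDefinedSolution : (k : ℕ) (p : Fin k → ℕ) (s : Fin k → ℕ)
                        (a : (i : Fin k) → Fin (p i) → ℕ) (c : ℕ) (A : ℕ → ℕ) → Set
IsWellDefinedSolution k p s a c A =
    (∀ n → 1 ≤ n → n ≤ c → 1 ≤ A n)
    -- well-definedness: every argument on the right-hand side is a positive integer
  × (∀ n → c < n → ∀ i j → a i j < n)
  × (∀ n → c < n → ∀ i → s i + innerSum k p a A n i < n)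
    -- the recursion (subtractions are exact by the two previous conditions)
  × (∀ n → c < n →
       A n ≡ sumFin (λ i → A (n ∸ s i ∸ innerSum k p a A n i)))
  where open import Relation.Binary.PropositionalEquality using (_≡_)

-- r A m = A(m+1)/(m+1), i.e. the sequence A(n)/n for n ≥ 1.
ratio : (ℕ → ℕ) → ℕ → ℚ
ratio A m = (+ A (suc m)) / suc m

-- A sequence of rationals converges (to some real number) iff it is Cauchy.
IsCauchy : (ℕ → ℚ) → Set
IsCauchy r = ∀ ε → Positive ε → ∃ λ N → ∀ m n → N ≤ m → N ≤ n → ∣ r m - r n ∣ ℚ.< ε

-- For a convergent sequence: the limit is ≠ 0 iff the sequence is
-- eventually bounded away from 0.
BoundedAwayFromZero : (ℕ → ℚ) → Set
BoundedAwayFromZero r = ∃ λ ε → Positive ε × ∃ λ N → ∀ n → N ≤ n → ε ℚ.≤ ∣ r n ∣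

ConvergesTo : (ℕ → ℚ) → ℚ → Set
ConvergesTo r L = ∀ ε → Positive ε → ∃ λ N → ∀ n → N ≤ n → ∣ r n - L ∣ ℚ.< ε

module Submission where

-- Write x = A(n)/n.  Being Cauchy, the ratio lets x·m approximate A(m) for all
-- m ≤ n up to η·n + C (Cauchy beyond a threshold, a constant below it).  Pushing this
-- approximation through one application of the recursion (inner terms ≈ x·n, inner
-- sums ≈ pᵢ·x·n, outer arguments ≈ n - pᵢ·x·n, outer terms ≈ x·(n - pᵢ·x·n)) and using
-- A(n) = x·n exactly gives the asymptotic limit equation
--   x·n·|x·P - (k-1)| ≤ K·η·n + D_η.
-- Since x ≥ δ > 0 eventually, P·|x - (k-1)/P| is O(η) + O(1/n) for every η, so it tends to 0.

module RationalFacts where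

  open import Data.Nat as ℕ using (ℕ; zero; suc)
  import Data.Nat.Properties as ℕP
  open import Data.Integer as ℤ using (+_)
  import Data.Integer.Properties as ℤP
  open import Data.Rational
  open import Data.Rational.Properties
  import Data.Rational.Unnormalised as U
  import Data.Rational.Unnormalised.Properties as UP
  open import Data.Rational.Solver
  open import Data.Fin using (Fin; zero; suc)
  open import Data.Product using (∃; _,_; proj₁; proj₂)
  open import Relation.Binary.PropositionalEquality
  open import Defs using (sumFin)
  open +-*-Solver

  ≤-scaleˡ : ∀ {c p q} → 0ℚ ≤ c → p ≤ q → c * p ≤ c * q
  ≤-scaleˡ {c} 0≤c = *-monoˡ-≤-nonNeg c {{nonNegative 0≤c}}

  ≤-scaleʳ : ∀ {c p q} → 0ℚ ≤ c → p ≤ q → p * c ≤ q * c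
  ≤-scaleʳ {c} 0≤c = *-monoʳ-≤-nonNeg c {{nonNegative 0≤c}}

  0≤* : ∀ {p q} → 0ℚ ≤ p → 0ℚ ≤ q → 0ℚ ≤ p * q
  0≤* {p} 0≤p 0≤q = subst (_≤ p * _) (*-zeroʳ p) (≤-scaleˡ 0≤p 0≤q)

  *-mono-≤-nonNeg : ∀ {p q r s} → 0ℚ ≤ p → 0ℚ ≤ r → p ≤ q → r ≤ s → p * r ≤ q * s
  *-mono-≤-nonNeg 0≤p 0≤r p≤q r≤s = ≤-trans (≤-scaleʳ 0≤r p≤q) (≤-scaleˡ (≤-trans 0≤p p≤q) r≤s)

  0<* : ∀ {p q} → 0ℚ < p → 0ℚ < q → 0ℚ < p * q
  0<* {p} {q} 0<p 0<q = positive⁻¹ (p * q) {{pos*pos⇒pos p {{positive 0<p}} q {{positive 0<q}}}}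

  ≤-+-nonNeg : ∀ {p q r} → p ≤ q → 0ℚ ≤ r → p ≤ q + r
  ≤-+-nonNeg {p} p≤q 0≤r = subst (_≤ _) (+-identityʳ p) (+-mono-≤ p≤q 0≤r)

  ι : ℕ → ℚ
  ι n = + n / 1

  private
    toℚᵘ-ι : ∀ n → toℚᵘ (ι n) U.≃ U.mkℚᵘ (+ n) 0
    toℚᵘ-ι n = toℚᵘ-fromℚᵘ (U.mkℚᵘ (+ n) 0)

  ι-+ : ∀ m n → ι (m ℕ.+ n) ≡ ι m + ι n
  ι-+ m n = toℚᵘ-injective (UP.≃-trans (toℚᵘ-ι (m ℕ.+ n)) (UP.≃-trans
     (U.*≡* (cong (ℤ._* + 1) (trans (ℤP.pos-+ m n)
       (sym (cong₂ ℤ._+_ (ℤP.*-identityʳ (+ m)) (ℤP.*-identityʳ (+ n)))))))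
     (UP.≃-sym (UP.≃-trans (toℚᵘ-homo-+ (ι m) (ι n)) (UP.+-cong (toℚᵘ-ι m) (toℚᵘ-ι n))))))

  ι-suc : ∀ n → ι (suc n) ≡ 1ℚ + ι n
  ι-suc = ι-+ 1

  0≤ι : ∀ n → 0ℚ ≤ ι n
  0≤ι n = nonNegative⁻¹ (ι n) {{normalize-nonNeg n 1}}

  ι-mono : ∀ {m n} → m ℕ.≤ n → ι m ≤ ι n
  ι-mono {m} {n} m≤n = subst (ι m ≤_) (trans (sym (ι-+ m (n ℕ.∸ m))) (cong ι (ℕP.m+[n∸m]≡n m≤n)))
     (≤-+-nonNeg ≤-refl (0≤ι (n ℕ.∸ m)))

  ι-∸ : ∀ {m n} → n ℕ.≤ m → ι (m ℕ.∸ n) ≡ ι m - ι n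
  ι-∸ {m} {n} n≤m = begin
    ι (m ℕ.∸ n)              ≡⟨ solve 2 (λ x y → x := (x :+ y) :- y) refl (ι (m ℕ.∸ n)) (ι n) ⟩
    ι (m ℕ.∸ n) + ι n - ι n  ≡⟨ cong (_- ι n) (sym (ι-+ (m ℕ.∸ n) n)) ⟩
    ι (m ℕ.∸ n ℕ.+ n) - ι n  ≡⟨ cong (λ z → ι z - ι n) (ℕP.m∸n+n≡m n≤m) ⟩
    ι m - ι n                ∎
    where open ≡-Reasoning

  fraction-cancel : ∀ a b → (+ a / suc b) * ι (suc b) ≡ ι a
  fraction-cancel a b = toℚᵘ-injective (UP.≃-trans (toℚᵘ-homo-* (+ a / suc b) (ι (suc b)))
    (UP.≃-trans (UP.*-cong (toℚᵘ-fromℚᵘ (U.mkℚᵘ (+ a) b)) (toℚᵘ-ι (suc b)))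
    (UP.≃-trans (U.*≡* cross) (UP.≃-sym (toℚᵘ-ι a)))))
    where
    cross : (+ a ℤ.* + suc b) ℤ.* + 1 ≡ + a ℤ.* + suc (b ℕ.* 1)
    cross = trans (ℤP.*-identityʳ _) (cong (λ z → + a ℤ.* + suc z) (sym (ℕP.*-identityʳ b)))

  ι-<-suc : ∀ n → ι n < ι (suc n)
  ι-<-suc n = subst₂ _<_ (+-identityʳ (ι n)) (trans (+-comm (ι n) 1ℚ) (sym (ι-suc n)))
                (+-monoʳ-< (ι n) (positive⁻¹ 1ℚ))

  below-natural : ∀ z → ∃ λ m → z ≤ ι m
  below-natural z@(mkℚ ℤ.-[1+ _ ] _ _) = 0 , <⇒≤ (negative⁻¹ z)
  below-natural (mkℚ (+ n) d _) = n , toℚᵘ-cancel-≤ (UP.≤-respʳ-≃ (UP.≃-sym (toℚᵘ-ι n))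
     (U.*≤* (subst₂ ℤ._≤_ (ℤP.pos-* n 1) (ℤP.pos-* n (suc d)) (ℤ.+≤+ (ℕP.*-monoʳ-≤ n (ℕ.s≤s ℕ.z≤n))))))

  archimedean : ∀ y q → 0ℚ < q → ∃ λ m → y < ι m * q
  archimedean y q 0<q = suc m , (begin-strict
      y                  ≡⟨ sym (trans (*-assoc y (1/ q) q) (trans (cong (y *_) (*-inverseˡ q)) (*-identityʳ y))) ⟩
      y * 1/ q * q       ≤⟨ ≤-scaleʳ (<⇒≤ 0<q) y/q≤m ⟩
      ι m * q            <⟨ *-monoˡ-<-pos q (ι-<-suc m) ⟩
      ι (suc m) * q      ∎)
    where
    open ≤-Reasoning
    instance
      q≢0 : NonZero q
      q≢0 = pos⇒nonZero q {{positive 0<q}}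
      q⁺ : Positive q
      q⁺ = positive 0<q
    m : ℕ
    m = proj₁ (below-natural (y * 1/ q))
    y/q≤m : y * 1/ q ≤ ι m
    y/q≤m = proj₂ (below-natural (y * 1/ q))

  dist : ℚ → ℚ → ℚ
  dist u v = ∣ u - v ∣

  dist-triangle : ∀ u v w → dist u w ≤ dist u v + dist v w
  dist-triangle u v w = subst (λ z → ∣ z ∣ ≤ dist u v + dist v w)
    (solve 3 (λ u v w → (u :- v) :+ (v :- w) := u :- w) refl u v w)
    (∣p+q∣≤∣p∣+∣q∣ (u - v) (v - w))

  dist-- : ∀ u u' v v' → dist (u - u') (v - v') ≤ dist u v + dist u' v'
  dist-- u u' v v' = subst (λ z → ∣ z ∣ ≤ dist u v + dist u' v')
    (solve 4 (λ u u' v v' → (u :- v) :- (u' :- v') := (u :- u') :- (v :- v')) refl u u' v v')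
    (∣p-q∣≤∣p∣+∣q∣ (u - v) (u' - v'))

  dist-scale : ∀ c u v → 0ℚ ≤ c → dist (c * u) (c * v) ≡ c * dist u v
  dist-scale c u v 0≤c = begin
    ∣ c * u - c * v ∣     ≡⟨ cong ∣_∣ (solve 3 (λ c u v → c :* u :- c :* v := c :* (u :- v)) refl c u v) ⟩
    ∣ c * (u - v) ∣       ≡⟨ ∣p*q∣≡∣p∣*∣q∣ c (u - v) ⟩
    ∣ c ∣ * dist u v      ≡⟨ cong (_* dist u v) (0≤p⇒∣p∣≡p 0≤c) ⟩
    c * dist u v          ∎
    where open ≡-Reasoning

  dist-shift : ∀ u v → 0ℚ ≤ v → dist (u - v) u ≡ v
  dist-shift u v 0≤v = begin
    ∣ (u - v) - u ∣  ≡⟨ cong ∣_∣ (solve 2 (λ u v → (u :- v) :- u := :- v) refl u v) ⟩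
    ∣ - v ∣          ≡⟨ ∣-p∣≡∣p∣ v ⟩
    ∣ v ∣            ≡⟨ 0≤p⇒∣p∣≡p 0≤v ⟩
    v                ∎
    where open ≡-Reasoning

  dist-≤-+ : ∀ u v → 0ℚ ≤ u → 0ℚ ≤ v → dist u v ≤ u + v
  dist-≤-+ u v 0≤u 0≤v =
    subst (dist u v ≤_) (cong₂ _+_ (0≤p⇒∣p∣≡p 0≤u) (0≤p⇒∣p∣≡p 0≤v)) (∣p-q∣≤∣p∣+∣q∣ u v)

  dist-multiple : ∀ y t → 0ℚ ≤ y → dist y (y * t) ≡ y * ∣ 1ℚ - t ∣
  dist-multiple y t 0≤y = begin
    ∣ y - y * t ∣          ≡⟨ cong ∣_∣ (solve 2 (λ y t → y :- y :* t := y :* (con 1ℚ :- t)) refl y t) ⟩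
    ∣ y * (1ℚ - t) ∣       ≡⟨ ∣p*q∣≡∣p∣*∣q∣ y (1ℚ - t) ⟩
    ∣ y ∣ * ∣ 1ℚ - t ∣     ≡⟨ cong (_* ∣ 1ℚ - t ∣) (0≤p⇒∣p∣≡p 0≤y) ⟩
    y * ∣ 1ℚ - t ∣         ∎
    where open ≡-Reasoning

  sumQ : ∀ {k} → (Fin k → ℚ) → ℚ
  sumQ {zero}  g = 0ℚ
  sumQ {suc k} g = g zero + sumQ (λ i → g (suc i))

  sumQ-cong : ∀ k (f g : Fin k → ℚ) → (∀ i → f i ≡ g i) → sumQ f ≡ sumQ g
  sumQ-cong zero    f g f≡g = refl
  sumQ-cong (suc k) f g f≡g =
    cong₂ _+_ (f≡g zero) (sumQ-cong k (λ i → f (suc i)) (λ i → g (suc i)) (λ i → f≡g (suc i)))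

  sumQ-approx : ∀ k (f : Fin k → ℕ) (g : Fin k → ℚ) e → (∀ i → dist (ι (f i)) (g i) ≤ e) →
                dist (ι (sumFin f)) (sumQ g) ≤ ι k * e
  sumQ-approx zero    f g e close = ≤-reflexive (trans (cong ∣_∣ (+-inverseʳ 0ℚ)) (sym (*-zeroˡ e)))
  sumQ-approx (suc k) f g e close = begin
    dist (ι (f zero ℕ.+ F)) (g zero + G)     ≡⟨ cong (λ z → dist z (g zero + G)) (ι-+ (f zero) F) ⟩
    dist (ι (f zero) + ι F) (g zero + G)     ≤⟨ dist-+ ⟩
    dist (ι (f zero)) (g zero) + dist (ι F) G
       ≤⟨ +-mono-≤ (close zero) (sumQ-approx k (λ i → f (suc i)) (λ i → g (suc i)) e (λ i → close (suc i))) ⟩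
    e + ι k * e                              ≡⟨ solve 2 (λ e x → e :+ x :* e := (con 1ℚ :+ x) :* e) refl e (ι k) ⟩
    (1ℚ + ι k) * e                           ≡⟨ cong (_* e) (sym (ι-suc k)) ⟩
    ι (suc k) * e                            ∎
    where
    open ≤-Reasoning
    F : ℕ
    F = sumFin (λ i → f (suc i))
    G : ℚ
    G = sumQ (λ i → g (suc i))
    dist-+ : dist (ι (f zero) + ι F) (g zero + G) ≤ dist (ι (f zero)) (g zero) + dist (ι F) G
    dist-+ = subst (λ z → ∣ z ∣ ≤ dist (ι (f zero)) (g zero) + dist (ι F) G)
      (solve 4 (λ a b c d → (a :- c) :+ (b :- d) := (a :+ b) :- (c :+ d)) refl (ι (f zero)) (ι F) (g zero) G)
      (∣p+q∣≤∣p∣+∣q∣ (ι (f zero) - g zero) (ι F - G))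

  sumQ-const : ∀ k c → sumQ {k} (λ _ → c) ≡ ι k * c
  sumQ-const zero    c = sym (*-zeroˡ c)
  sumQ-const (suc k) c = begin
    c + sumQ {k} (λ _ → c)  ≡⟨ cong (λ z → c + z) (sumQ-const k c) ⟩
    c + ι k * c             ≡⟨ solve 2 (λ c x → c :+ x :* c := (con 1ℚ :+ x) :* c) refl c (ι k) ⟩
    (1ℚ + ι k) * c          ≡⟨ cong (_* c) (sym (ι-suc k)) ⟩
    ι (suc k) * c           ∎
    where open ≡-Reasoning

  sumQ-affine : ∀ k (p : Fin k → ℕ) u v → sumQ (λ i → u - ι (p i) * v) ≡ ι k * u - ι (sumFin p) * v
  sumQ-affine zero    p u v = solve 2 (λ u v → con 0ℚ := con 0ℚ :* u :- con 0ℚ :* v) refl u v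
  sumQ-affine (suc k) p u v = begin
    (u - ι (p zero) * v) + sumQ (λ i → u - ι (p (suc i)) * v)
      ≡⟨ cong (λ z → (u - ι (p zero) * v) + z) (sumQ-affine k (λ i → p (suc i)) u v) ⟩
    (u - ι (p zero) * v) + (ι k * u - ι P' * v)
      ≡⟨ solve 5 (λ u v a b x → (u :- a :* v) :+ (x :* u :- b :* v) := (con 1ℚ :+ x) :* u :- (a :+ b) :* v)
               refl u v (ι (p zero)) (ι P') (ι k) ⟩
    (1ℚ + ι k) * u - (ι (p zero) + ι P') * v
      ≡⟨ cong₂ (λ a b → a * u - b * v) (sym (ι-suc k)) (sym (ι-+ (p zero) P')) ⟩
    ι (suc k) * u - ι (sumFin p) * v ∎
    where
    open ≡-Reasoning
    P' : ℕ
    P' = sumFin (λ i → p (suc i))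

  sumFin-positive : ∀ k (f : Fin k → ℕ) → 1 ℕ.≤ k → (∀ i → 1 ℕ.≤ f i) → 1 ℕ.≤ sumFin f
  sumFin-positive (suc k) f _ f≥1 = ℕP.≤-trans (f≥1 zero) (ℕP.m≤m+n (f zero) _)

  ≤-sumFin : ∀ k (f : Fin k → ℕ) i → f i ℕ.≤ sumFin f
  ≤-sumFin (suc k) f zero    = ℕP.m≤m+n (f zero) _
  ≤-sumFin (suc k) f (suc i) = ℕP.≤-trans (≤-sumFin k (λ j → f (suc j)) i) (ℕP.m≤n+m _ (f zero))

module Asymptotics where

  open import Data.Nat as ℕ using (ℕ; zero; suc; _∸_)
  import Data.Nat.Properties as ℕP
  open import Data.Rational
  open import Data.Rational.Properties
  open import Data.Rational.Solver
  open import Data.Fin using (Fin)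
  open import Data.Product using (∃; _×_; _,_; proj₁; proj₂)
  open import Data.Sum using (inj₁; inj₂)
  open import Relation.Binary.PropositionalEquality
  open import Relation.Nullary using (yes; no)
  open import Defs
  open RationalFacts
  open +-*-Solver

  maxBelow : (ℕ → ℕ) → ℕ → ℕ
  maxBelow A zero    = 0
  maxBelow A (suc N) = A N ℕ.⊔ maxBelow A N

  maxBelow-≥ : ∀ A N m → m ℕ.< N → A m ℕ.≤ maxBelow A N
  maxBelow-≥ A (suc N) m (ℕ.s≤s m≤N) with ℕP.m≤n⇒m<n∨m≡n m≤N
  ... | inj₁ m<N = ℕP.≤-trans (maxBelow-≥ A N m m<N) (ℕP.m≤n⊔m (A N) _)
  ... | inj₂ refl = ℕP.m≤m⊔n (A m) _

  ratio-nonNeg : ∀ A n → 0ℚ ≤ ratio A n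
  ratio-nonNeg A n = nonNegative⁻¹ (ratio A n) {{normalize-nonNeg (A (suc n)) (suc n)}}

  ratio-cancel : ∀ A n → ratio A n * ι (suc n) ≡ ι (A (suc n))
  ratio-cancel A n = fraction-cancel (A (suc n)) n

  eventually-bounded : ∀ r → (∀ n → 0ℚ ≤ r n) → IsCauchy r → ∃ λ B → ∃ λ N → ∀ n → N ℕ.≤ n → r n ≤ B
  eventually-bounded r 0≤r cauchy = r N + 1ℚ , N , bound
    where
    N : ℕ
    N = proj₁ (cauchy 1ℚ _)
    bound : ∀ n → N ℕ.≤ n → r n ≤ r N + 1ℚ
    bound n N≤n = begin
      r n                      ≡⟨ sym (0≤p⇒∣p∣≡p (0≤r n)) ⟩
      ∣ r n ∣                  ≡⟨ cong ∣_∣ (solve 2 (λ x y → x := y :+ (x :- y)) refl (r n) (r N)) ⟩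
      ∣ r N + (r n - r N) ∣    ≤⟨ ∣p+q∣≤∣p∣+∣q∣ (r N) (r n - r N) ⟩
      ∣ r N ∣ + ∣ r n - r N ∣  ≤⟨ +-mono-≤ (≤-reflexive (0≤p⇒∣p∣≡p (0≤r N)))
                                         (<⇒≤ (proj₂ (cauchy 1ℚ _) n N N≤n ℕP.≤-refl)) ⟩
      r N + 1ℚ                 ∎
      where open ≤-Reasoning

  -- If A(n)/n is Cauchy and eventually at most B, then for every η > 0 and all large n,
  -- x = A(n+1)/(n+1) approximates A linearly on all of [0, n+1] up to η·(n+1) + C:
  -- beyond the Cauchy threshold by the Cauchy property, below it by a constant.
  uniform-approximation : ∀ A B N₀ → (∀ n → N₀ ℕ.≤ n → ratio A n ≤ B) → IsCauchy (ratio A) →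
    ∀ η → Positive η → ∃ λ C → ∃ λ N → ∀ n → N ℕ.≤ n → ∀ m → m ℕ.≤ suc n →
      dist (ι (A m)) (ratio A n * ι m) ≤ η * ι (suc n) + C
  uniform-approximation A B N₀ bounded cauchy η η>0 = C , N₀ ℕ.⊔ Nη , close
    where
    Nη : ℕ
    Nη = proj₁ (cauchy η η>0)
    C : ℚ
    C = ι (maxBelow A (suc Nη)) + B * ι (suc Nη)
    0≤η : 0ℚ ≤ η
    0≤η = <⇒≤ (positive⁻¹ η {{η>0}})

    -- beyond the Cauchy threshold: A(m+1) = r(m)·(m+1) and |r(m) - r(n)| < η
    beyond : ∀ n → Nη ℕ.≤ n → ∀ m → Nη ℕ.≤ m →
             dist (ι (A (suc m))) (ratio A n * ι (suc m)) ≤ η * ι (suc m)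
    beyond n Nη≤n m Nη≤m = begin
      dist (ι (A (suc m))) (ratio A n * ι (suc m))      ≡⟨ cong (λ z → dist z (ratio A n * ι (suc m)))
                                                                 (sym (ratio-cancel A m)) ⟩
      dist (ratio A m * ι (suc m)) (ratio A n * ι (suc m)) ≡⟨ cong₂ dist (*-comm (ratio A m) _) (*-comm (ratio A n) _) ⟩
      dist (ι (suc m) * ratio A m) (ι (suc m) * ratio A n) ≡⟨ dist-scale (ι (suc m)) _ _ (0≤ι (suc m)) ⟩
      ι (suc m) * dist (ratio A m) (ratio A n)            ≤⟨ ≤-scaleˡ (0≤ι (suc m))
                                                               (<⇒≤ (proj₂ (cauchy η η>0) m n Nη≤m Nη≤n)) ⟩
      ι (suc m) * η                                       ≡⟨ *-comm (ι (suc m)) η ⟩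
      η * ι (suc m)                                       ∎
      where open ≤-Reasoning

    -- below the threshold: A(m) ≤ max A and x·m ≤ B·Nη
    below : ∀ n → N₀ ℕ.≤ n → ∀ m → m ℕ.< suc Nη → dist (ι (A m)) (ratio A n * ι m) ≤ C
    below n N₀≤n m m<N = ≤-trans
      (dist-≤-+ (ι (A m)) _ (0≤ι (A m)) (0≤* (ratio-nonNeg A n) (0≤ι m)))
      (+-mono-≤ (ι-mono (maxBelow-≥ A (suc Nη) m m<N))
                (*-mono-≤-nonNeg (ratio-nonNeg A n) (0≤ι m) (bounded n N₀≤n) (ι-mono (ℕP.<⇒≤ m<N))))

    close : ∀ n → N₀ ℕ.⊔ Nη ℕ.≤ n → ∀ m → m ℕ.≤ suc n →
            dist (ι (A m)) (ratio A n * ι m) ≤ η * ι (suc n) + C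
    close n N≤n m m≤n with Nη ℕ.<? m
    ... | yes (ℕ.s≤s {n = m'} Nη≤m') = ≤-trans (beyond n (ℕP.m⊔n≤o⇒n≤o N₀ Nη N≤n) m' Nη≤m')
            (≤-+-nonNeg (≤-scaleˡ 0≤η (ι-mono m≤n)) 0≤C)
      where
      0≤C : 0ℚ ≤ C
      0≤C = ≤-trans (0≤∣p∣ _) (below n (ℕP.m⊔n≤o⇒m≤o N₀ Nη N≤n) 0 (ℕ.s≤s ℕ.z≤n))
    ... | no Nη≮m = ≤-trans (below n (ℕP.m⊔n≤o⇒m≤o N₀ Nη N≤n) m (ℕ.s≤s (ℕP.≮⇒≥ Nη≮m)))
            (subst (C ≤_) (+-comm C _) (≤-+-nonNeg ≤-refl (0≤* 0≤η (0≤ι (suc n)))))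

  -- One application of the recursion at n propagates a uniform linear approximation:
  -- if |A(m) - x·m| ≤ e for all m ≤ n, then A(n) is close to Σᵢ x·(n - pᵢ·x·n).
  module RecursionStep
    (k : ℕ) (p s : Fin k → ℕ) (a : (i : Fin k) → Fin (p i) → ℕ) (A : ℕ → ℕ)
    (n : ℕ) (x B e : ℚ) (α σ : ℕ)
    (0≤x : 0ℚ ≤ x) (x≤B : x ≤ B)
    (approx : ∀ m → m ℕ.≤ n → dist (ι (A m)) (x * ι m) ≤ e)
    (a≤α : ∀ i j → a i j ℕ.≤ α) (s≤σ : ∀ i → s i ℕ.≤ σ)
    (a≤n : ∀ i j → a i j ℕ.≤ n) (s+S≤n : ∀ i → s i ℕ.+ innerSum k p a A n i ℕ.≤ n)
    where

    P : ℕ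
    P = sumFin p

    S : Fin k → ℕ
    S = innerSum k p a A n

    arg : Fin k → ℕ
    arg i = n ∸ s i ∸ S i

    inner-error outer-error : ℚ
    inner-error = e + B * ι α
    outer-error = e + B * (ι σ + ι P * inner-error)

    0≤inner-error : 0ℚ ≤ inner-error
    0≤inner-error = +-mono-≤ (≤-trans (0≤∣p∣ _) (approx 0 ℕ.z≤n)) (0≤* (≤-trans 0≤x x≤B) (0≤ι α))

    -- A(n - aᵢⱼ) ≈ x·(n - aᵢⱼ) ≈ x·n, the second step costing x·aᵢⱼ ≤ B·α.
    inner-term : ∀ i j → dist (ι (A (n ∸ a i j))) (x * ι n) ≤ inner-error
    inner-term i j = begin
      dist (ι (A t)) (x * ι n)                       ≤⟨ dist-triangle (ι (A t)) (x * ι t) (x * ι n) ⟩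
      dist (ι (A t)) (x * ι t) + dist (x * ι t) (x * ι n)
                                                     ≡⟨ cong (λ z → dist (ι (A t)) (x * ι t) + z) shift ⟩
      dist (ι (A t)) (x * ι t) + x * ι (a i j)       ≤⟨ +-mono-≤ (approx t (ℕP.m∸n≤m n (a i j)))
                                                          (*-mono-≤-nonNeg 0≤x (0≤ι (a i j)) x≤B (ι-mono (a≤α i j))) ⟩
      inner-error                                    ∎
      where
      open ≤-Reasoning
      t : ℕ
      t = n ∸ a i j
      shift : dist (x * ι t) (x * ι n) ≡ x * ι (a i j)
      shift = begin-equality
        dist (x * ι t) (x * ι n)         ≡⟨ dist-scale x (ι t) (ι n) 0≤x ⟩
        x * dist (ι t) (ι n)             ≡⟨ cong (λ z → x * dist z (ι n)) (ι-∸ (a≤n i j)) ⟩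
        x * dist (ι n - ι (a i j)) (ι n) ≡⟨ cong (x *_) (dist-shift (ι n) (ι (a i j)) (0≤ι (a i j))) ⟩
        x * ι (a i j)                    ∎

    inner-sum : ∀ i → dist (ι (S i)) (ι (p i) * (x * ι n)) ≤ ι (p i) * inner-error
    inner-sum i = subst (λ z → dist (ι (S i)) z ≤ ι (p i) * inner-error) (sumQ-const (p i) (x * ι n))
      (sumQ-approx (p i) (λ j → A (n ∸ a i j)) (λ _ → x * ι n) inner-error (inner-term i))

    argument : ∀ i → dist (ι (arg i)) (ι n - ι (p i) * (x * ι n)) ≤ ι σ + ι P * inner-error
    argument i = begin
      dist (ι (arg i)) (ι n - ι (p i) * (x * ι n))
        ≡⟨ cong (λ z → dist z (ι n - ι (p i) * (x * ι n))) (trans (ι-∸ S≤n-s) (cong (_- ι (S i)) (ι-∸ s≤n))) ⟩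
      dist (ι n - ι (s i) - ι (S i)) (ι n - ι (p i) * (x * ι n))
        ≤⟨ dist-- (ι n - ι (s i)) (ι (S i)) (ι n) (ι (p i) * (x * ι n)) ⟩
      dist (ι n - ι (s i)) (ι n) + dist (ι (S i)) (ι (p i) * (x * ι n))
        ≤⟨ +-mono-≤ (≤-reflexive (dist-shift (ι n) (ι (s i)) (0≤ι (s i)))) (inner-sum i) ⟩
      ι (s i) + ι (p i) * inner-error
        ≤⟨ +-mono-≤ (ι-mono (s≤σ i)) (≤-scaleʳ 0≤inner-error (ι-mono (≤-sumFin k p i))) ⟩
      ι σ + ι P * inner-error ∎
      where
      open ≤-Reasoning
      s≤n : s i ℕ.≤ n
      s≤n = ℕP.m+n≤o⇒m≤o (s i) (s+S≤n i)
      S≤n-s : S i ℕ.≤ n ∸ s i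
      S≤n-s = ℕP.m+n≤o⇒m≤o∸n (S i) (subst (ℕ._≤ n) (ℕP.+-comm (s i) (S i)) (s+S≤n i))

    -- A(argᵢ) ≈ x·argᵢ ≈ x·(n - pᵢ·x·n).
    outer-term : ∀ i → dist (ι (A (arg i))) (x * (ι n - ι (p i) * (x * ι n))) ≤ outer-error
    outer-term i = begin
      dist (ι (A (arg i))) (x * T)                          ≤⟨ dist-triangle (ι (A (arg i))) (x * ι (arg i)) (x * T) ⟩
      dist (ι (A (arg i))) (x * ι (arg i)) + dist (x * ι (arg i)) (x * T)
                                                            ≡⟨ cong (λ z → dist (ι (A (arg i))) (x * ι (arg i)) + z)
                                                                    (dist-scale x (ι (arg i)) T 0≤x) ⟩
      dist (ι (A (arg i))) (x * ι (arg i)) + x * dist (ι (arg i)) T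
                                                            ≤⟨ +-mono-≤ (approx (arg i) arg≤n)
                                                                 (*-mono-≤-nonNeg 0≤x (0≤∣p∣ _) x≤B (argument i)) ⟩
      outer-error                                           ∎
      where
      open ≤-Reasoning
      T : ℚ
      T = ι n - ι (p i) * (x * ι n)
      arg≤n : arg i ℕ.≤ n
      arg≤n = ℕP.≤-trans (ℕP.m∸n≤m (n ∸ s i) (S i)) (ℕP.m∸n≤m n (s i))

    -- Summing over i: Σᵢ x·(n - pᵢ·x·n) = x·n·(k - x·P).
    one-step-error : A n ≡ sumFin (λ i → A (arg i)) →
                     dist (ι (A n)) (x * ι n * (ι k - x * ι P)) ≤ ι k * outer-error
    one-step-error recursion = subst₂ (λ u v → dist (ι u) v ≤ ι k * outer-error) (sym recursion) sum-identity
      (sumQ-approx k (λ i → A (arg i)) (λ i → x * (ι n - ι (p i) * (x * ι n))) outer-error outer-term)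
      where
      open ≡-Reasoning
      sum-identity : sumQ (λ i → x * (ι n - ι (p i) * (x * ι n))) ≡ x * ι n * (ι k - x * ι P)
      sum-identity = begin
        sumQ (λ i → x * (ι n - ι (p i) * (x * ι n)))
          ≡⟨ sumQ-cong k _ _ (λ i → solve 3 (λ x n q → x :* (n :- q :* (x :* n)) := x :* n :- q :* (x :* (x :* n)))
                                              refl x (ι n) (ι (p i))) ⟩
        sumQ (λ i → x * ι n - ι (p i) * (x * (x * ι n)))
          ≡⟨ sumQ-affine k p (x * ι n) (x * (x * ι n)) ⟩
        ι k * (x * ι n) - ι P * (x * (x * ι n))
          ≡⟨ solve 4 (λ x n K P → K :* (x :* n) :- P :* (x :* (x :* n)) := x :* n :* (K :- x :* P)) refl x (ι n) (ι k) (ι P) ⟩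
        x * ι n * (ι k - x * ι P) ∎

  -- The limit equation L = k·L - P·L² holds asymptotically for x = A(n+1)/(n+1):
  --   x·(n+1)·|1 - (k - x·P)| ≤ K·η·(n+1) + D   for every η > 0 and all large n,
  -- with K > 0 independent of η.  This is one application of the recursion to the
  -- uniform linear approximation, using A(n+1) = x·(n+1) exactly.
  limit-equation : ∀ k (p s : Fin k → ℕ) a c A → 1 ℕ.≤ k → IsWellDefinedSolution k p s a c A →
    IsCauchy (ratio A) → ∃ λ K → 0ℚ < K × (∀ η → Positive η → ∃ λ D → ∃ λ N → ∀ n → N ℕ.≤ n →
      ratio A n * ι (suc n) * ∣ 1ℚ - (ι k - ratio A n * ι (sumFin p)) ∣ ≤ K * η * ι (suc n) + D)
  limit-equation k p s a c A k≥1 (_ , a<n , s+S<n , recursion) cauchy = K , 0<K , bound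
    where
    P : ℚ
    P = ι (sumFin p)
    α σ : ℕ
    α = sumFin (λ i → sumFin (a i))
    σ = sumFin s
    bounded-above = eventually-bounded (ratio A) (ratio-nonNeg A) cauchy
    B : ℚ
    B = proj₁ bounded-above
    N₀ : ℕ
    N₀ = proj₁ (proj₂ bounded-above)
    bounded : ∀ n → N₀ ℕ.≤ n → ratio A n ≤ B
    bounded = proj₂ (proj₂ bounded-above)
    0≤B : 0ℚ ≤ B
    0≤B = ≤-trans (ratio-nonNeg A N₀) (bounded N₀ ℕP.≤-refl)
    K : ℚ
    K = ι k * (1ℚ + B * P)
    0<K : 0ℚ < K
    0<K = 0<* (<-≤-trans (positive⁻¹ 1ℚ) (ι-mono k≥1))
              (<-≤-trans (positive⁻¹ 1ℚ) (≤-+-nonNeg ≤-refl (0≤* 0≤B (0≤ι (sumFin p)))))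
    a≤α : ∀ i j → a i j ℕ.≤ α
    a≤α i j = ℕP.≤-trans (≤-sumFin (p i) (a i) j) (≤-sumFin k (λ i → sumFin (a i)) i)

    bound : ∀ η → Positive η → ∃ λ D → ∃ λ N → ∀ n → N ℕ.≤ n →
            ratio A n * ι (suc n) * ∣ 1ℚ - (ι k - ratio A n * P) ∣ ≤ K * η * ι (suc n) + D
    bound η η>0 = D , (c ℕ.⊔ N₀) ℕ.⊔ N , estimate
      where
      approximation = uniform-approximation A B N₀ bounded cauchy η η>0
      C : ℚ
      C = proj₁ approximation
      N : ℕ
      N = proj₁ (proj₂ approximation)
      D : ℚ
      D = ι k * ((1ℚ + B * P) * C + B * (ι σ + P * (B * ι α)))

      estimate : ∀ n → (c ℕ.⊔ N₀) ℕ.⊔ N ℕ.≤ n →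
                 ratio A n * ι (suc n) * ∣ 1ℚ - (ι k - ratio A n * P) ∣ ≤ K * η * ι (suc n) + D
      estimate n N≤n = begin
        x * m * ∣ 1ℚ - (ι k - x * P) ∣      ≡⟨ sym (dist-multiple (x * m) (ι k - x * P) (0≤* 0≤x (0≤ι (suc n)))) ⟩
        dist (x * m) (x * m * (ι k - x * P)) ≡⟨ cong (λ z → dist z (x * m * (ι k - x * P))) (ratio-cancel A n) ⟩
        dist (ι (A (suc n))) (x * m * (ι k - x * P)) ≤⟨ one-step-error (recursion (suc n) c<n) ⟩
        ι k * outer-error                   ≡⟨ solve 9 (λ k B P C η m σ α x →
                                                  k :* ((η :* m :+ C) :+ B :* (σ :+ P :* ((η :* m :+ C) :+ B :* α)))
                                                  := k :* (con 1ℚ :+ B :* P) :* η :* m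
                                                     :+ k :* ((con 1ℚ :+ B :* P) :* C :+ B :* (σ :+ P :* (B :* α))))
                                                refl (ι k) B P C η m (ι σ) (ι α) x ⟩
        K * η * m + D                       ∎
        where
        open ≤-Reasoning
        x m : ℚ
        x = ratio A n
        m = ι (suc n)
        0≤x : 0ℚ ≤ x
        0≤x = ratio-nonNeg A n
        c⊔N₀≤n : c ℕ.⊔ N₀ ℕ.≤ n
        c⊔N₀≤n = ℕP.m⊔n≤o⇒m≤o (c ℕ.⊔ N₀) N N≤n
        c<n : c ℕ.< suc n
        c<n = ℕ.s≤s (ℕP.m⊔n≤o⇒m≤o c N₀ c⊔N₀≤n)
        open RecursionStep k p s a A (suc n) x B (η * m + C) α σ 0≤x
               (bounded n (ℕP.m⊔n≤o⇒n≤o c N₀ c⊔N₀≤n))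
               (proj₂ (proj₂ approximation) n (ℕP.m⊔n≤o⇒n≤o (c ℕ.⊔ N₀) N N≤n))
               a≤α (≤-sumFin k s)
               (λ i j → ℕP.<⇒≤ (a<n (suc n) c<n i j)) (λ i → ℕP.<⇒≤ (s+S<n (suc n) c<n i))
               using (outer-error; one-step-error)

  WeightedBound : (ℕ → ℚ) → ℚ → ℚ → Set
  WeightedBound e c K =
    ∀ η → Positive η → ∃ λ D → ∃ λ N → ∀ n → N ℕ.≤ n → c * e n * ι (suc n) ≤ K * η * ι (suc n) + D

  -- A vanishing criterion: such an e tends to 0.  Take η with 2K·η = c·ε, then n
  -- large enough that D < K·η·(n+1).

  vanishing : ∀ (e : ℕ → ℚ) c K → 0ℚ < c → 0ℚ < K → WeightedBound e c K →
    ∀ ε → Positive ε → ∃ λ N → ∀ n → N ℕ.≤ n → e n < ε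
  vanishing e c K 0<c 0<K bound ε ε>0 = N ℕ.⊔ n₀ , small
    where
    0<2K : 0ℚ < K + K
    0<2K = +-mono-< 0<K 0<K
    instance
      2K≢0 : NonZero (K + K)
      2K≢0 = pos⇒nonZero (K + K) {{positive 0<2K}}
    η : ℚ
    η = c * ε * 1/ (K + K)
    0<η : 0ℚ < η
    0<η = 0<* (0<* 0<c (positive⁻¹ ε {{ε>0}})) (positive⁻¹ _ {{1/pos⇒pos (K + K) {{positive 0<2K}}}})
    2Kη≡cε : K * η + K * η ≡ c * ε
    2Kη≡cε = begin
      K * η + K * η                  ≡⟨ solve 3 (λ K h w → K :* (h :* w) :+ K :* (h :* w) := h :* ((K :+ K) :* w))
                                                refl K (c * ε) (1/ (K + K)) ⟩
      c * ε * ((K + K) * 1/ (K + K)) ≡⟨ cong (c * ε *_) (*-inverseʳ (K + K)) ⟩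
      c * ε * 1ℚ                     ≡⟨ *-identityʳ (c * ε) ⟩
      c * ε                          ∎
      where open ≡-Reasoning
    eventually = bound η (positive 0<η)
    D : ℚ
    D = proj₁ eventually
    N n₀ : ℕ
    N = proj₁ (proj₂ eventually)
    n₀ = proj₁ (archimedean D (K * η) (0<* 0<K 0<η))
    D<Kηn₀ = proj₂ (archimedean D (K * η) (0<* 0<K 0<η))

    small : ∀ n → N ℕ.⊔ n₀ ℕ.≤ n → e n < ε
    small n N⊔n₀≤n = *-cancelˡ-<-nonNeg (c * m) {{nonNegative (0≤* (<⇒≤ 0<c) (0≤ι (suc n)))}} (begin-strict
      c * m * e n            ≡⟨ solve 3 (λ c m e → c :* m :* e := c :* e :* m) refl c m (e n) ⟩
      c * e n * m            ≤⟨ proj₂ (proj₂ eventually) n (ℕP.m⊔n≤o⇒m≤o N n₀ N⊔n₀≤n) ⟩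
      K * η * m + D          <⟨ +-monoʳ-< (K * η * m) (<-≤-trans D<Kηn₀ (subst (_ ≤_) (*-comm m (K * η))
                                  (≤-scaleʳ (<⇒≤ (0<* 0<K 0<η)) (ι-mono (ℕP.m≤n⇒m≤1+n n₀≤n))))) ⟩
      K * η * m + K * η * m  ≡⟨ solve 3 (λ a b m → a :* m :+ b :* m := (a :+ b) :* m) refl (K * η) (K * η) m ⟩
      (K * η + K * η) * m    ≡⟨ cong (_* m) 2Kη≡cε ⟩
      c * ε * m              ≡⟨ solve 3 (λ c ε m → c :* ε :* m := c :* m :* ε) refl c ε m ⟩
      c * m * ε              ∎)
      where
      open ≤-Reasoning
      m : ℚ
      m = ι (suc n)
      n₀≤n : n₀ ℕ.≤ n
      n₀≤n = ℕP.m⊔n≤o⇒n≤o N n₀ N⊔n₀≤n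

  -- If f·P = L - 1 then P·|x - f| = |1 - (L - x·P)|, so a lower bound δ ≤ x turns the
  -- limit equation into a bound on the weighted error |x - f|.
  weighted-error : ∀ {x f P L δ m} → 0ℚ ≤ P → 0ℚ ≤ m → f * P ≡ L - 1ℚ → 0ℚ ≤ x → δ ≤ ∣ x ∣ →
                   δ * P * ∣ x - f ∣ * m ≤ x * m * ∣ 1ℚ - (L - x * P) ∣
  weighted-error {x} {f} {P} {L} {δ} {m} 0≤P 0≤m fP≡L-1 0≤x δ≤∣x∣ = begin
    δ * P * ∣ x - f ∣ * m        ≡⟨ solve 4 (λ δ P e m → δ :* P :* e :* m := δ :* m :* (e :* P)) refl δ P ∣ x - f ∣ m ⟩
    δ * m * (∣ x - f ∣ * P)      ≡⟨ cong (δ * m *_) scaled ⟩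
    δ * m * ∣ 1ℚ - (L - x * P) ∣ ≤⟨ ≤-scaleʳ (0≤∣p∣ _) (≤-scaleʳ 0≤m (subst (δ ≤_) (0≤p⇒∣p∣≡p 0≤x) δ≤∣x∣)) ⟩
    x * m * ∣ 1ℚ - (L - x * P) ∣ ∎
    where
    open ≤-Reasoning
    scaled : ∣ x - f ∣ * P ≡ ∣ 1ℚ - (L - x * P) ∣
    scaled = begin-equality
      ∣ x - f ∣ * P              ≡⟨ cong (∣ x - f ∣ *_) (sym (0≤p⇒∣p∣≡p 0≤P)) ⟩
      ∣ x - f ∣ * ∣ P ∣          ≡⟨ sym (∣p*q∣≡∣p∣*∣q∣ (x - f) P) ⟩
      ∣ (x - f) * P ∣            ≡⟨ cong ∣_∣ (solve 3 (λ x f P → (x :- f) :* P := x :* P :- f :* P) refl x f P) ⟩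
      ∣ x * P - f * P ∣          ≡⟨ cong (λ z → ∣ x * P - z ∣) fP≡L-1 ⟩
      ∣ x * P - (L - 1ℚ) ∣       ≡⟨ cong ∣_∣ (solve 3 (λ x P L → x :* P :- (L :- con 1ℚ) := con 1ℚ :- (L :- x :* P))
                                                   refl x P L) ⟩
      ∣ 1ℚ - (L - x * P) ∣       ∎

  frac-cancel : ∀ k P → 1 ℕ.≤ k → 1 ℕ.≤ P → frac (k ∸ 1) P * ι P ≡ ι k - 1ℚ
  frac-cancel k (suc P) k≥1 _ = trans (fraction-cancel (k ∸ 1) P) (ι-∸ k≥1)

open import Data.Nat using (ℕ; suc; _≤_; _∸_; _⊔_)
import Data.Nat.Properties as ℕP
open import Data.Fin using (Fin)
open import Data.Rational using (ℚ; ∣_∣; _-_; _*_; 0ℚ; _<_)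
open import Data.Rational.Properties using (≤-trans; <-≤-trans; positive⁻¹)
open import Data.Product using (_,_; proj₁; proj₂)
open import Defs
open RationalFacts
open Asymptotics

theorem2p1 : (k : ℕ) (p : Fin k → ℕ) (s : Fin k → ℕ) (a : (i : Fin k) → Fin (p i) → ℕ)
    (c : ℕ) (A : ℕ → ℕ) →
    1 ≤ k →
    (∀ i → 1 ≤ p i) →
    (∀ i j → 1 ≤ a i j) →
    IsWellDefinedSolution k p s a c A →
    IsCauchy (ratio A) →
    BoundedAwayFromZero (ratio A) →
    ConvergesTo (ratio A) (frac (k ∸ 1) (sumFin p))
theorem2p1 k p s a c A k≥1 p≥1 _ solution cauchy (δ , δ>0 , Nδ , away) =
  vanishing error (δ * ι P) K 0<δP 0<K weighted-bound
  where
  limit = limit-equation k p s a c A k≥1 solution cauchy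
  K : ℚ
  K = proj₁ limit
  0<K : 0ℚ < K
  0<K = proj₁ (proj₂ limit)
  P : ℕ
  P = sumFin p
  P≥1 : 1 ≤ P
  P≥1 = sumFin-positive k p k≥1 p≥1
  error : ℕ → ℚ
  error n = ∣ ratio A n - frac (k ∸ 1) P ∣
  0<δP : 0ℚ < δ * ι P
  0<δP = 0<* (positive⁻¹ δ {{δ>0}}) (<-≤-trans (positive⁻¹ _) (ι-mono P≥1))
  weighted-bound : WeightedBound error (δ * ι P) K
  weighted-bound η η>0 = D , N ⊔ Nδ , λ n N⊔Nδ≤n →
    ≤-trans (weighted-error {L = ι k} (0≤ι P) (0≤ι (suc n)) (frac-cancel k P k≥1 P≥1) (ratio-nonNeg A n)
                            (away n (ℕP.m⊔n≤o⇒n≤o N Nδ N⊔Nδ≤n)))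
            (bound n (ℕP.m⊔n≤o⇒m≤o N Nδ N⊔Nδ≤n))
    where
    eventually = proj₂ (proj₂ limit) η η>0
    D : ℚ
    D = proj₁ eventually
    N : ℕ
    N = proj₁ (proj₂ eventually)
    bound = proj₂ (proj₂ eventually)
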